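{- Let $k$ be a positive integer, let $a\ge k+2$ and $G=K_a\,\Box\,K_a$. Then $\gamma_{P,k}(G-v)=a-k-1$ for every vertex $v$ of $G$.
   Context: $K_a$ is the complete graph on $a$ vertices and $\Box$ denotes the Cartesian product: $V(G\Box H)=V(G)\times V(H)$, with $(g,h)$ adjacent to $(g',h')$ iff either $g=g'$ and $hh'\in E(H)$, or $h=h'$ and $gg'\in E(G)$. $G-v$ is obtained by deleting $v$ and its incident edges. $N_G[v]$ is the closed neighbourhood of $v$ and $N_G[S]=\bigcup_{v\in S}N_G[v]$. For $S\subseteq V(G)$, define $\mathcal{P}^{0}_{G,k}(S)=N_G[S]$ and $\mathcal{P}^{t+1}_{G,k}(S)=\bigcup\{N_G[u] : u\in \mathcal{P}^{t}_{G,k}(S),\ |N_G[u]\setminus \mathcal{P}^{t}_{G,k}(S)|\le k\}$; these sets increase and stabilize to $\mathcal{P}^{\infty}_{G,k}(S)$. $S$ is a $k$-power dominating set if $\mathcal{P}^{\infty}_{G,k}(S)=V(G)$; $\gamma_{P,k}(G)$ is the minimum size of such a set. -}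

module Defs where

open import Data.Nat using (ℕ; _≤ᵇ_; _≤_)
open import Data.Bool using (Bool; true; false; _∧_; _∨_; not; T)
open import Data.List using (List; length; filter; cartesianProduct; allFin)
open import Data.Bool.ListAction using (any)
open import Data.List.Membership.Propositional using (_∈_)
open import Data.List.Relation.Unary.Unique.Propositional using (Unique)
open import Data.Fin using (Fin)
open import Data.Fin.Properties renaming (_≟_ to _≟F_)
open import Data.Product using (_×_; _,_; ∃; Σ)
open import Data.Product.Properties using (≡-dec)
open import Relation.Binary.PropositionalEquality using (_≡_)
open import Relation.Binary.Definitions using (DecidableEquality)
open import Relation.Nullary.Decidable using (⌊_⌋; ¬?)

record Graph : Set₁ where
  field
    V     : Set
    _≟_   : DecidableEquality V
    verts : List V
    adj   : V → V → Bool

  N[_] : V → V → Bool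
  N[ u ] w = ⌊ w ≟ u ⌋ ∨ adj u w

  count : (V → Bool) → ℕ
  count P = length (filter (λ x → T? (P x)) verts)
    where
      open import Data.Bool.Properties using (T?)

open Graph public

VSet : Graph → Set
VSet G = V G → Bool

P0 : (G : Graph) → List (V G) → VSet G
P0 G S w = any (λ u → N[_] G u w) S

step : (G : Graph) → ℕ → VSet G → VSet G
step G k P w =
  any (λ u → P u ∧ (count G (λ x → N[_] G u x ∧ not (P x)) ≤ᵇ k) ∧ N[_] G u w) (verts G)

Pt : (G : Graph) → ℕ → List (V G) → ℕ → VSet G
Pt G k S ℕ.zero    = P0 G S
Pt G k S (ℕ.suc t) = step G k (Pt G k S t)

-- S is a k-power dominating set: S ⊆ V(G) and P^∞(S) = V(G)
-- (the P^t increase, so P^∞ = V(G) iff some P^t contains every vertex)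
IsPDS : (G : Graph) → ℕ → List (V G) → Set
IsPDS G k S =
  (∀ s → s ∈ S → s ∈ verts G) × ∃ λ t → ∀ w → w ∈ verts G → T (Pt G k S t w)

γPk≡ : (G : Graph) → ℕ → ℕ → Set
γPk≡ G k m =
  (∃ λ S → Unique S × length S ≡ m × IsPDS G k S) ×
  (∀ S → Unique S → IsPDS G k S → m ≤ length S)

KaKa : ℕ → Graph
KaKa a = record
  { V = Fin a × Fin a
  ; _≟_ = ≡-dec _≟F_ _≟F_
  ; verts = cartesianProduct (allFin a) (allFin a)
  ; adj = λ { (g , h) (g' , h') →
        (⌊ g ≟F g' ⌋ ∧ not ⌊ h ≟F h' ⌋) ∨ (⌊ h ≟F h' ⌋ ∧ not ⌊ g ≟F g' ⌋) }
  }

_-v_ : (G : Graph) → V G → Graph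
G -v v = record
  { V = V G
  ; _≟_ = _≟_ G
  ; verts = filter (λ w → ¬? (_≟_ G w v)) (verts G)
  ; adj = λ u w → adj G u w ∧ not ⌊ _≟_ G u v ⌋ ∧ not ⌊ _≟_ G w v ⌋
  }

-- Write v = (p , q) and a = n + 1, so the claim is γ = n ∸ k.  Call a row or column occupied
-- if it meets S.
--
-- Lower bound: every observed cell lies on an occupied line.  Indeed, a cell on an occupied row
-- but an unoccupied column has, in that column, an unobserved neighbour for every row that is
-- neither occupied nor p; if |S| < n ∸ k there are more than k of them, so it cannot force
-- (symmetrically for columns).  A cell in a free row and a free column is then never observed.
--
-- Upper bound: take n ∸ k cells of the diagonal (punchIn p l , punchIn q l), which avoids row p
-- and column q, so only k rows besides p and k columns besides q are free.  A cell y is forced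
-- by the cell u where its row meets an occupied column, as soon as the only unobserved cells of
-- that row lie in free columns other than q.  This holds at time 0 when y's row is occupied or
-- is row p (dually for columns), and at time 1 for every row.

module Submission where

open import Defs
open import Data.Nat using (ℕ; _+_; _∸_; _≤_)
open import Data.List.Membership.Propositional using (_∈_)
open import Data.Bool using (Bool; true; false; _∧_; _∨_; not; T)
open import Data.Bool.Properties using (T?; T-∧; T-∨; ∧-zeroʳ; ∧-identityʳ)
open import Data.Bool.ListAction using (any)
open import Data.Empty using (⊥-elim)
open import Data.Fin using (Fin; zero; suc; toℕ; punchIn)
open import Data.Fin.Properties using (punchInᵢ≢i; punchIn-injective) renaming (_≟_ to _≟F_)
open import Data.List using (List; []; _∷_; _++_; length; filter; map; tabulate; allFin; cartesianProduct)
open import Data.List.Properties using (length-++; length-map; filter-++; map-tabulate)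
open import Data.List.Membership.Propositional using (find; lose)
open import Data.List.Membership.Propositional.Properties
  using (∈-filter⁺; ∈-filter⁻; ∈-cartesianProduct⁺; ∈-allFin; ∈-map⁺; ∈-map⁻)
open import Data.List.Relation.Unary.Any.Properties using (any⁺; any⁻)
open import Data.List.Relation.Unary.Unique.Propositional using (Unique)
import Data.List.Relation.Unary.Unique.Propositional.Properties as Unique
open import Data.Nat using (zero; suc; _<_; _<ᵇ_; z≤n; s≤s)
open import Data.Nat.Properties hiding (_≟_)
open import Data.Product using (_×_; _,_; ∃; proj₁; proj₂)
open import Data.Product.Properties using (≡-dec)
open import Data.Sum using (_⊎_; inj₁; inj₂; [_,_]′)
open import Function using (_∘_)
open import Function.Bundles using (Equivalence)
open import Relation.Nullary using (¬_; Dec; yes; no; does; _×-dec_)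
open import Relation.Nullary.Decidable
  using (⌊_⌋; ¬?; isYes≗does; dec-true; dec-false; toWitness; toWitnessFalse; fromWitness; fromWitnessFalse)
open import Relation.Unary using (Decidable)
open import Relation.Binary.PropositionalEquality
  using (_≡_; _≢_; refl; sym; trans; cong; cong₂; subst; module ≡-Reasoning)
open import Algebra.Properties.CommutativeMonoid.Sum +-0-commutativeMonoid
  using (sum; sum-remove; sum-cong-≗; ∑-distrib-+; ∑-comm)

open Equivalence using (to; from)

⌊⌋-true : ∀ {A : Set} (a? : Dec A) → A → ⌊ a? ⌋ ≡ true
⌊⌋-true a? a = trans (isYes≗does a?) (dec-true a? a)

⌊⌋-false : ∀ {A : Set} (a? : Dec A) → ¬ A → ⌊ a? ⌋ ≡ false
⌊⌋-false a? ¬a = trans (isYes≗does a?) (dec-false a? ¬a)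

T-not⁺ : ∀ {x} → ¬ T x → T (not x)
T-not⁺ {false} _  = _
T-not⁺ {true}  ¬x = ¬x _

T-not⁻ : ∀ {x} → T (not x) → ¬ T x
T-not⁻ {false} _ ()

bit : Bool → ℕ
bit false = 0
bit true  = 1

card : ∀ {n} → (Fin n → Bool) → ℕ
card P = sum (λ i → bit (P i))

sum-mono-≤ : ∀ {n} {f g : Fin n → ℕ} → (∀ i → f i ≤ g i) → sum f ≤ sum g
sum-mono-≤ {zero}  f≤g = z≤n
sum-mono-≤ {suc n} f≤g = +-mono-≤ (f≤g zero) (sum-mono-≤ (λ i → f≤g (suc i)))

sum-zero : ∀ {n} {f : Fin n → ℕ} → (∀ i → f i ≡ 0) → sum f ≡ 0
sum-zero {zero}  f≡0 = refl
sum-zero {suc n} f≡0 = cong₂ _+_ (f≡0 zero) (sum-zero (λ i → f≡0 (suc i)))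

card-mono : ∀ {n} {P Q : Fin n → Bool} → (∀ i → T (P i) → T (Q i)) → card P ≤ card Q
card-mono {P = P} {Q} P⊆Q = sum-mono-≤ (λ i → bit-mono (P i) (Q i) (P⊆Q i))
  where
  bit-mono : ∀ x y → (T x → T y) → bit x ≤ bit y
  bit-mono false _     _   = z≤n
  bit-mono true  true  _   = ≤-refl
  bit-mono true  false x⇒y = ⊥-elim (x⇒y _)

card-empty : ∀ {n} (P : Fin n → Bool) → (∀ i → ¬ T (P i)) → card P ≡ 0
card-empty P P≡∅ = sum-zero (λ i → bit-false (P i) (P≡∅ i))
  where
  bit-false : ∀ x → ¬ T x → bit x ≡ 0
  bit-false false _  = refl
  bit-false true  ¬x = ⊥-elim (¬x _)

card-nonempty : ∀ {n} (P : Fin n → Bool) → 0 < card P → ∃ λ i → T (P i)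
card-nonempty {suc n} P 0<∣P∣ with P zero in eq
... | true  = zero , subst T (sym eq) _
... | false with card-nonempty (λ i → P (suc i)) 0<∣P∣
...   | i , Pi = suc i , Pi

card-∨ : ∀ {n} (P Q : Fin n → Bool) → card (λ i → P i ∨ Q i) ≤ card P + card Q
card-∨ P Q = begin
  card (λ i → P i ∨ Q i)             ≤⟨ sum-mono-≤ (λ i → bit-∨ (P i) (Q i)) ⟩
  sum (λ i → bit (P i) + bit (Q i))  ≡⟨ ∑-distrib-+ (λ i → bit (P i)) (λ i → bit (Q i)) ⟩
  card P + card Q                    ∎
  where
  open ≤-Reasoning
  bit-∨ : ∀ x y → bit (x ∨ y) ≤ bit x + bit y
  bit-∨ false y = ≤-refl
  bit-∨ true  y = s≤s z≤n

card+card-not : ∀ {n} (P : Fin n → Bool) → card P + card (λ i → not (P i)) ≡ n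
card+card-not {n} P = begin
  card P + card (λ i → not (P i))         ≡⟨ ∑-distrib-+ (λ i → bit (P i)) (λ i → bit (not (P i))) ⟨
  sum (λ i → bit (P i) + bit (not (P i))) ≡⟨ sum-cong-≗ (λ i → bit+bit-not (P i)) ⟩
  sum {n} (λ _ → 1)                       ≡⟨ sum-ones n ⟩
  n                                       ∎
  where
  open ≡-Reasoning
  bit+bit-not : ∀ x → bit x + bit (not x) ≡ 1
  bit+bit-not false = refl
  bit+bit-not true  = refl
  sum-ones : ∀ n → sum {n} (λ _ → 1) ≡ n
  sum-ones zero    = refl
  sum-ones (suc n) = cong suc (sum-ones n)

card-punchIn : ∀ {n} (r : Fin (suc n)) (P : Fin (suc n) → Bool) →
               card P ≡ bit (P r) + card (λ l → P (punchIn r l))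
card-punchIn r P = sum-remove {i = r} (λ i → bit (P i))

card-avoiding : ∀ {n} (r : Fin (suc n)) (P : Fin (suc n) → Bool) →
                card (λ i → P i ∧ not ⌊ i ≟F r ⌋) ≡ card (λ l → P (punchIn r l))
card-avoiding r P = begin
  card P′                                       ≡⟨ card-punchIn r P′ ⟩
  bit (P′ r) + card (λ l → P′ (punchIn r l))    ≡⟨ cong₂ _+_ (cong bit at-r) (sum-cong-≗ (cong bit ∘ off-r)) ⟩
  card (λ l → P (punchIn r l))                  ∎
  where
  open ≡-Reasoning
  P′ : Fin _ → Bool
  P′ i = P i ∧ not ⌊ i ≟F r ⌋
  at-r : P′ r ≡ false
  at-r = trans (cong (λ b → P r ∧ not b) (⌊⌋-true (r ≟F r) refl)) (∧-zeroʳ (P r))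
  off-r : ∀ l → P′ (punchIn r l) ≡ P (punchIn r l)
  off-r l = trans (cong (λ b → P (punchIn r l) ∧ not b) (⌊⌋-false (punchIn r l ≟F r) (punchInᵢ≢i r l)))
                  (∧-identityʳ (P (punchIn r l)))

card-singleton : ∀ {n} (c : Fin (suc n)) → card (λ i → ⌊ c ≟F i ⌋) ≡ 1
card-singleton c = begin
  card (λ i → ⌊ c ≟F i ⌋)                               ≡⟨ card-punchIn c (λ i → ⌊ c ≟F i ⌋) ⟩
  bit ⌊ c ≟F c ⌋ + card (λ l → ⌊ c ≟F punchIn c l ⌋)   ≡⟨ cong₂ _+_ (cong bit (⌊⌋-true (c ≟F c) refl)) others-empty ⟩
  1                                                      ∎
  where
  open ≡-Reasoning
  others-empty : card (λ l → ⌊ c ≟F punchIn c l ⌋) ≡ 0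
  others-empty = card-empty _ (λ l c≡ → punchInᵢ≢i c l (sym (toWitness c≡)))

card-<ᵇ : ∀ {n m} → m ≤ n → card {n} (λ i → toℕ i <ᵇ m) ≡ m
card-<ᵇ {n}     {zero}  _         = card-empty {n} (λ i → toℕ i <ᵇ zero) (λ i ())
card-<ᵇ {suc n} {suc m} (s≤s m≤n) = cong suc (card-<ᵇ m≤n)

card-not : ∀ {n} (P : Fin n → Bool) → card (λ i → not (P i)) ≡ n ∸ card P
card-not P = trans (sym (m+n∸m≡n (card P) _)) (cong (_∸ card P) (card+card-not P))

card-free-≥ : ∀ {n} (r : Fin (suc n)) (P : Fin (suc n) → Bool) →
              n ∸ card P ≤ card (λ i → not (P i) ∧ not ⌊ i ≟F r ⌋)
card-free-≥ {n} r P = begin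
  n ∸ card P                               ≤⟨ ∸-monoʳ-≤ n punchIn-fewer ⟩
  n ∸ card (λ l → P (punchIn r l))         ≡⟨ card-not (λ l → P (punchIn r l)) ⟨
  card (λ l → not (P (punchIn r l)))       ≡⟨ card-avoiding r (λ i → not (P i)) ⟨
  card (λ i → not (P i) ∧ not ⌊ i ≟F r ⌋)  ∎
  where
  open ≤-Reasoning
  punchIn-fewer : card (λ l → P (punchIn r l)) ≤ card P
  punchIn-fewer = subst (card (λ l → P (punchIn r l)) ≤_) (sym (card-punchIn r P)) (m≤n+m _ (bit (P r)))

card-free-≤ : ∀ {n} (r : Fin (suc n)) (P : Fin (suc n) → Bool) (Q : Fin n → Bool) →
              (∀ l → T (Q l) → T (P (punchIn r l))) →
              card (λ i → not (P i) ∧ not ⌊ i ≟F r ⌋) ≤ n ∸ card Q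
card-free-≤ {n} r P Q Q⊆P = begin
  card (λ i → not (P i) ∧ not ⌊ i ≟F r ⌋)  ≡⟨ card-avoiding r (λ i → not (P i)) ⟩
  card (λ l → not (P (punchIn r l)))       ≤⟨ card-mono (λ l ¬P → T-not⁺ (λ Q-l → T-not⁻ ¬P (Q⊆P l Q-l))) ⟩
  card (λ l → not (Q l))                   ≡⟨ card-not Q ⟩
  n ∸ card Q                               ∎
  where open ≤-Reasoning

length-filter-filter : ∀ {A : Set} {P Q : A → Set} (P? : Decidable P) (Q? : Decidable Q) xs →
  length (filter Q? (filter P? xs)) ≡ length (filter (λ x → P? x ×-dec Q? x) xs)
length-filter-filter P? Q? [] = refl
length-filter-filter P? Q? (x ∷ xs) with does (P? x)
... | false = length-filter-filter P? Q? xs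
... | true with does (Q? x)
...   | true  = cong suc (length-filter-filter P? Q? xs)
...   | false = length-filter-filter P? Q? xs

length-filter-tabulate : ∀ {A : Set} {P : A → Set} (P? : Decidable P) {n} (f : Fin n → A) →
  length (filter P? (tabulate f)) ≡ card (λ i → does (P? (f i)))
length-filter-tabulate P? {zero}  f = refl
length-filter-tabulate P? {suc n} f with does (P? (f zero))
... | true  = cong suc (length-filter-tabulate P? (λ i → f (suc i)))
... | false = length-filter-tabulate P? (λ i → f (suc i))

length-filter-cartesianProduct : ∀ {A B : Set} {P : A × B → Set} (P? : Decidable P) {n}
  (f : Fin n → A) (ys : List B) →
  length (filter P? (cartesianProduct (tabulate f) ys)) ≡
  sum (λ i → length (filter P? (map (f i ,_) ys)))
length-filter-cartesianProduct P? {zero}  f ys = refl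
length-filter-cartesianProduct P? {suc n} f ys = begin
  length (filter P? (row₀ ++ rest))                   ≡⟨ cong length (filter-++ P? row₀ rest) ⟩
  length (filter P? row₀ ++ filter P? rest)           ≡⟨ length-++ (filter P? row₀) ⟩
  length (filter P? row₀) + length (filter P? rest)
    ≡⟨ cong (length (filter P? row₀) +_) (length-filter-cartesianProduct P? (f ∘ suc) ys) ⟩
  sum (λ i → length (filter P? (map (f i ,_) ys)))    ∎
  where
  open ≡-Reasoning
  row₀ = map (f zero ,_) ys
  rest = cartesianProduct (tabulate (f ∘ suc)) ys

length-filter-grid : ∀ {m n} {P : Fin m × Fin n → Set} (P? : Decidable P) →
  length (filter P? (cartesianProduct (allFin m) (allFin n))) ≡ sum (λ i → card (λ j → does (P? (i , j))))
length-filter-grid {m} {n} P? = begin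
  length (filter P? (cartesianProduct (allFin m) (allFin n)))
    ≡⟨ length-filter-cartesianProduct P? (λ i → i) (allFin n) ⟩
  sum (λ i → length (filter P? (map (i ,_) (allFin n))))
    ≡⟨ sum-cong-≗ (λ i → cong (length ∘ filter P?) (map-tabulate (λ j → j) (i ,_))) ⟩
  sum (λ i → length (filter P? (tabulate (i ,_))))
    ≡⟨ sum-cong-≗ (λ i → length-filter-tabulate P? (i ,_)) ⟩
  sum (λ i → card (λ j → does (P? (i , j))))
    ∎
  where open ≡-Reasoning

Forcing : (G : Graph) → ℕ → VSet G → V G → Set
Forcing G k Q u = T (Q u) × count G (λ x → N[_] G u x ∧ not (Q x)) ≤ k

P0⁻ : ∀ G S w → T (P0 G S w) → ∃ λ s → s ∈ S × T (N[_] G s w)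
P0⁻ G S w w∈P0 = find (any⁻ (λ s → N[_] G s w) S w∈P0)

P0⁺ : ∀ G {S s} w → s ∈ S → T (N[_] G s w) → T (P0 G S w)
P0⁺ G w s∈S s→w = any⁺ (λ s → N[_] G s w) (lose s∈S s→w)

step⁻ : ∀ G k Q w → T (step G k Q w) → ∃ λ u → u ∈ verts G × Forcing G k Q u × T (N[_] G u w)
step⁻ G k Q w w∈step with find (any⁻ _ (verts G) w∈step)
... | u , u∈G , forces with to T-∧ forces
...   | Qu , rest with to T-∧ rest
...     | small , u→w = u , u∈G , (Qu , ≤ᵇ⇒≤ _ k small) , u→w

step⁺ : ∀ G k Q w {u} → u ∈ verts G → Forcing G k Q u → T (N[_] G u w) → T (step G k Q w)
step⁺ G k Q w u∈G (Qu , small) u→w =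
  any⁺ _ (lose u∈G (from T-∧ (Qu , from T-∧ (≤⇒≤ᵇ small , u→w))))

N-v⁺ : ∀ H v {u w} → u ≢ v → w ≢ v → w ≡ u ⊎ T (adj H u w) → T (N[_] (H -v v) u w)
N-v⁺ H v {u} {w} u≢v w≢v (inj₁ w≡u) = from (T-∨ {⌊ _≟_ H w u ⌋}) (inj₁ (fromWitness w≡u))
N-v⁺ H v {u} {w} u≢v w≢v (inj₂ u~w) = from (T-∨ {⌊ _≟_ H w u ⌋}) (inj₂
  (from (T-∧ {adj H u w}) (u~w , from (T-∧ {not ⌊ _≟_ H u v ⌋}) (fromWitnessFalse u≢v , fromWitnessFalse w≢v))))

N-v⁻ : ∀ H v {u w} → T (N[_] (H -v v) u w) → w ≡ u ⊎ T (adj H u w)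
N-v⁻ H v {u} {w} u→w with to (T-∨ {⌊ _≟_ H w u ⌋}) u→w
... | inj₁ w≡u = inj₁ (toWitness w≡u)
... | inj₂ u~w = inj₂ (proj₁ (to (T-∧ {adj H u w}) u~w))

data Axis : Set where
  row col : Axis

perp : Axis → Axis
perp row = col
perp col = row

module _ {A : Set} where

  line : Axis → A × A → A
  line row = proj₁
  line col = proj₂

  along : Axis → A → A → A × A
  along row c x = c , x
  along col c x = x , c

  line-along : ∀ d c x → line d (along d c x) ≡ c
  line-along row c x = refl
  line-along col c x = refl

  line-perp-along : ∀ d c x → line (perp d) (along d c x) ≡ x
  line-perp-along row c x = refl
  line-perp-along col c x = refl

  cell-ext : ∀ d {y z : A × A} → line d y ≡ line d z → line (perp d) y ≡ line (perp d) z → y ≡ z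
  cell-ext row refl refl = refl
  cell-ext col refl refl = refl

axis-cases : ∀ d e → d ≡ e ⊎ d ≡ perp e
axis-cases row row = inj₁ refl
axis-cases row col = inj₂ refl
axis-cases col row = inj₂ refl
axis-cases col col = inj₁ refl

module Rook (n : ℕ) (v : Fin (suc n) × Fin (suc n)) where

  Cell : Set
  Cell = Fin (suc n) × Fin (suc n)

  G : Graph
  G = KaKa (suc n) -v v

  _≟C_ : (y z : Cell) → Dec (y ≡ z)
  _≟C_ = ≡-dec _≟F_ _≟F_

  alive : Cell → Bool
  alive y = not (does (y ≟C v))

  alive⁺ : ∀ {y} → y ≢ v → T (alive y)
  alive⁺ {y} y≢v = subst (λ b → T (not b)) (sym (dec-false (y ≟C v) y≢v)) _

  alive⁻ : ∀ {y} → T (alive y) → y ≢ v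
  alive⁻ {y} live y≡v = subst (λ b → T (not b)) (dec-true (y ≟C v) y≡v) live

  ∈G⁺ : ∀ {y} → y ≢ v → y ∈ verts G
  ∈G⁺ y≢v = ∈-filter⁺ (λ w → ¬? (w ≟C v)) (∈-cartesianProduct⁺ (∈-allFin _) (∈-allFin _)) y≢v

  ∈G⁻ : ∀ {y} → y ∈ verts G → y ≢ v
  ∈G⁻ y∈G = proj₂ (∈-filter⁻ (λ w → ¬? (w ≟C v)) {xs = verts (KaKa (suc n))} y∈G)

  lineCard : Axis → Fin (suc n) → (Cell → Bool) → ℕ
  lineCard d c F = card (λ x → alive (along d c x) ∧ F (along d c x))

  count-by-lines : ∀ d F → count G F ≡ sum (λ c → lineCard d c F)
  count-by-lines row F =
    trans (length-filter-filter (λ w → ¬? (w ≟C v)) (λ w → T? (F w)) (verts (KaKa (suc n))))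
          (length-filter-grid (λ w → ¬? (w ≟C v) ×-dec T? (F w)))
  count-by-lines col F = trans (count-by-lines row F) (∑-comm (λ c x → bit (alive (c , x) ∧ F (c , x))))

  count-split-line : ∀ d c F → count G F ≡ lineCard d c F + sum (λ l → lineCard d (punchIn c l) F)
  count-split-line d c F = trans (count-by-lines d F) (sum-remove {i = c} (λ c′ → lineCard d c′ F))

  lineCard≤count : ∀ d c F → lineCard d c F ≤ count G F
  lineCard≤count d c F = subst (lineCard d c F ≤_) (sym (count-split-line d c F)) (m≤m+n _ _)

  count≤lineCard : ∀ d c F → (∀ y → y ≢ v → T (F y) → line d y ≡ c) → count G F ≤ lineCard d c F
  count≤lineCard d c F F⊆line = ≤-reflexive (begin
    count G F                                                  ≡⟨ count-split-line d c F ⟩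
    lineCard d c F + sum (λ l → lineCard d (punchIn c l) F)    ≡⟨ cong (lineCard d c F +_) (sum-zero other-lines-empty) ⟩
    lineCard d c F + 0                                         ≡⟨ +-identityʳ _ ⟩
    lineCard d c F                                             ∎)
    where
    open ≡-Reasoning
    other-lines-empty : ∀ l → lineCard d (punchIn c l) F ≡ 0
    other-lines-empty l = card-empty _ λ x F-x → punchInᵢ≢i c l (trans (sym (line-along d (punchIn c l) x))
      (F⊆line _ (alive⁻ (proj₁ (to T-∧ F-x))) (proj₂ (to T-∧ F-x))))

  adj⁺ : ∀ d {u w : Cell} → line d u ≡ line d w → line (perp d) u ≢ line (perp d) w →
         T (adj (KaKa (suc n)) u w)
  adj⁺ row {g , h} {g′ , h′} g≡g′ h≢h′ = from (T-∨ {⌊ g ≟F g′ ⌋ ∧ _})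
    (inj₁ (from (T-∧ {⌊ g ≟F g′ ⌋}) (fromWitness g≡g′ , fromWitnessFalse h≢h′)))
  adj⁺ col {g , h} {g′ , h′} h≡h′ g≢g′ = from (T-∨ {⌊ g ≟F g′ ⌋ ∧ _})
    (inj₂ (from (T-∧ {⌊ h ≟F h′ ⌋}) (fromWitness h≡h′ , fromWitnessFalse g≢g′)))

  adj⁻ : ∀ {u w : Cell} → T (adj (KaKa (suc n)) u w) → proj₁ u ≡ proj₁ w ⊎ proj₂ u ≡ proj₂ w
  adj⁻ {g , h} {g′ , h′} u~w with to (T-∨ {⌊ g ≟F g′ ⌋ ∧ not ⌊ h ≟F h′ ⌋}) u~w
  ... | inj₁ same-row = inj₁ (toWitness (proj₁ (to (T-∧ {⌊ g ≟F g′ ⌋}) same-row)))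
  ... | inj₂ same-col = inj₂ (toWitness (proj₁ (to (T-∧ {⌊ h ≟F h′ ⌋}) same-col)))

  ≡⊎adj : ∀ d {u w : Cell} → line d u ≡ line d w → w ≡ u ⊎ T (adj (KaKa (suc n)) u w)
  ≡⊎adj d {u} {w} same with w ≟C u
  ... | yes w≡u = inj₁ w≡u
  ... | no  w≢u = inj₂ (adj⁺ d same (λ e → w≢u (sym (cell-ext d same e))))

  N-line : ∀ d {u w} → u ≢ v → w ≢ v → line d u ≡ line d w → T (N[_] G u w)
  N-line d u≢v w≢v same = N-v⁺ (KaKa (suc n)) v u≢v w≢v (≡⊎adj d same)

  N-line⁻ : ∀ d {u w} → T (N[_] G u w) → line d u ≡ line d w ⊎ line (perp d) u ≡ line (perp d) w
  N-line⁻ d {u} {w} u→w with N-v⁻ (KaKa (suc n)) v {u} {w} u→w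
  ... | inj₁ w≡u = inj₁ (cong (line d) (sym w≡u))
  ... | inj₂ u~w with adj⁻ u~w | d
  ...   | inj₁ same-row | row = inj₁ same-row
  ...   | inj₁ same-row | col = inj₂ same-row
  ...   | inj₂ same-col | row = inj₂ same-col
  ...   | inj₂ same-col | col = inj₁ same-col

  occupied : Axis → List Cell → Fin (suc n) → Bool
  occupied d S c = any (λ s → ⌊ line d s ≟F c ⌋) S

  occupied⁺ : ∀ d {S s c} → s ∈ S → line d s ≡ c → T (occupied d S c)
  occupied⁺ d s∈S s-on-c = any⁺ _ (lose s∈S (fromWitness s-on-c))

  occupied⁻ : ∀ d S c → T (occupied d S c) → ∃ λ s → s ∈ S × line d s ≡ c
  occupied⁻ d S c occ with find (any⁻ _ S occ)
  ... | s , s∈S , s-on-c = s , s∈S , toWitness s-on-c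

  card-occupied : ∀ d S → card (occupied d S) ≤ length S
  card-occupied d []      = ≤-reflexive (card-empty (occupied d []) (λ _ ()))
  card-occupied d (s ∷ S) = ≤-trans (card-∨ (λ c → ⌊ line d s ≟F c ⌋) (occupied d S))
    (+-mono-≤ (≤-reflexive (card-singleton (line d s))) (card-occupied d S))

  free : Axis → List Cell → Fin (suc n) → Bool
  free d S x = not (occupied d S x) ∧ not ⌊ x ≟F line d v ⌋

  free⁺ : ∀ d S x → ¬ T (occupied d S x) → x ≢ line d v → T (free d S x)
  free⁺ d S x unoccupied x≢v = from (T-∧ {not (occupied d S x)}) (T-not⁺ unoccupied , fromWitnessFalse x≢v)

  free⁻ : ∀ d S x → T (free d S x) → ¬ T (occupied d S x) × x ≢ line d v
  free⁻ d S x x-free with to (T-∧ {not (occupied d S x)}) x-free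
  ... | unoccupied , x≢v = T-not⁻ unoccupied , toWitnessFalse x≢v

  module LowerBound (k : ℕ) (S : List Cell) (k<n∸∣S∣ : k < n ∸ length S) where

    Covered : Cell → Set
    Covered y = ∃ λ d → T (occupied d S (line d y))

    many-free : ∀ d → k < card (free d S)
    many-free d = <-≤-trans k<n∸∣S∣
      (≤-trans (∸-monoʳ-≤ n (card-occupied d S)) (card-free-≥ (line d v) (occupied d S)))

    unforceable : ∀ (Q : VSet G) e {u} → u ≢ v → ¬ T (occupied e S (line e u)) →
                  (∀ y → T (Q y) → Covered y) → k < count G (λ x → N[_] G u x ∧ not (Q x))
    unforceable Q e {u} u≢v e-free Q⊆Covered =
      <-≤-trans (many-free (perp e)) (≤-trans (card-mono free⇒F) (lineCard≤count e (line e u) F))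
      where
      F : Cell → Bool
      F x = N[_] G u x ∧ not (Q x)
      free⇒F : ∀ x → T (free (perp e) S x) → T (alive (along e (line e u) x) ∧ F (along e (line e u) x))
      free⇒F x x-free =
        from (T-∧ {alive y}) (alive⁺ y≢v , from (T-∧ {N[_] G u y}) (u→y , T-not⁺ ¬Qy))
        where
        y = along e (line e u) x
        x≢v : x ≢ line (perp e) v
        x≢v = proj₂ (free⁻ (perp e) S x x-free)
        y≢v : y ≢ v
        y≢v y≡v = x≢v (trans (sym (line-perp-along e (line e u) x)) (cong (line (perp e)) y≡v))
        u→y : T (N[_] G u y)
        u→y = N-line e u≢v y≢v (sym (line-along e (line e u) x))
        ¬Qy : ¬ T (Q y)
        ¬Qy Qy with Q⊆Covered y Qy
        ... | d , occ with axis-cases d e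
        ...   | inj₁ refl = e-free (subst (T ∘ occupied e S) (line-along e (line e u) x) occ)
        ...   | inj₂ refl = proj₁ (free⁻ (perp e) S x x-free)
                                   (subst (T ∘ occupied (perp e) S) (line-perp-along e (line e u) x) occ)

    covered-step : ∀ Q {u w} → (∀ y → T (Q y) → Covered y) → u ≢ v → Forcing G k Q u → T (N[_] G u w) →
                   Covered w
    covered-step Q {u} Q⊆Covered u≢v (Qu , few-unobserved) u→w with Q⊆Covered u Qu
    ... | d , occ-d with T? (occupied (perp d) S (line (perp d) u))
    ...   | no  perp-free = ⊥-elim (<⇒≱ (unforceable Q (perp d) u≢v perp-free Q⊆Covered) few-unobserved)
    ...   | yes occ-perp with N-line⁻ d u→w
    ...     | inj₁ same = d , subst (T ∘ occupied d S) same occ-d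
    ...     | inj₂ same = perp d , subst (T ∘ occupied (perp d) S) same occ-perp

    observed⇒covered : ∀ t y → T (Pt G k S t y) → Covered y
    observed⇒covered zero y y∈P0 with P0⁻ G S y y∈P0
    ... | s , s∈S , s→y with N-line⁻ row s→y
    ...   | inj₁ same = row , occupied⁺ row s∈S same
    ...   | inj₂ same = col , occupied⁺ col s∈S same
    observed⇒covered (suc t) y y∈step with step⁻ G k (Pt G k S t) y y∈step
    ... | u , u∈G , forcing , u→y = covered-step (Pt G k S t) (observed⇒covered t) (∈G⁻ u∈G) forcing u→y

    ¬IsPDS : ¬ IsPDS G k S
    ¬IsPDS (_ , t , dominated)
      with card-nonempty (free row S) (≤-trans (s≤s z≤n) (many-free row))
         | card-nonempty (free col S) (≤-trans (s≤s z≤n) (many-free col))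
    ... | x , x-free | z , z-free
      with observed⇒covered t (x , z) (dominated (x , z) (∈G⁺ (proj₂ (free⁻ row S x x-free) ∘ cong proj₁)))
    ... | row , occ = proj₁ (free⁻ row S x x-free) occ
    ... | col , occ = proj₁ (free⁻ col S z z-free) occ

  module UpperBound (k : ℕ) (k<n : k < n) where

    m : ℕ
    m = n ∸ k

    diagonal : Fin n → Cell
    diagonal l = punchIn (proj₁ v) l , punchIn (proj₂ v) l

    line-diagonal : ∀ d l → line d (diagonal l) ≡ punchIn (line d v) l
    line-diagonal row l = refl
    line-diagonal col l = refl

    chosen : Fin n → Bool
    chosen l = toℕ l <ᵇ m

    chosen? : Decidable (T ∘ chosen)
    chosen? l = T? (chosen l)

    S : List Cell
    S = map diagonal (filter chosen? (allFin n))

    ∣S∣≡m : length S ≡ m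
    ∣S∣≡m = begin
      length S                              ≡⟨ length-map diagonal (filter chosen? (allFin n)) ⟩
      length (filter chosen? (allFin n))    ≡⟨ length-filter-tabulate chosen? (λ l → l) ⟩
      card chosen                           ≡⟨ card-<ᵇ (m∸n≤m n k) ⟩
      m                                     ∎
      where open ≡-Reasoning

    unique-S : Unique S
    unique-S = Unique.map⁺ (λ same → punchIn-injective (proj₁ v) _ _ (cong proj₁ same))
                           (Unique.filter⁺ chosen? (Unique.allFin⁺ n))

    diagonal≢v : ∀ l → diagonal l ≢ v
    diagonal≢v l = punchInᵢ≢i (proj₁ v) l ∘ cong proj₁

    S⊆G : ∀ s → s ∈ S → s ∈ verts G
    S⊆G s s∈S with ∈-map⁻ diagonal s∈S
    ... | l , _ , refl = ∈G⁺ (diagonal≢v l)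

    occupied-chosen : ∀ d l → T (chosen l) → T (occupied d S (punchIn (line d v) l))
    occupied-chosen d l chosen-l =
      occupied⁺ d (∈-map⁺ diagonal (∈-filter⁺ chosen? (∈-allFin l) chosen-l)) (line-diagonal d l)

    few-free : ∀ d → card (free d S) ≤ k
    few-free d = begin
      card (free d S)   ≤⟨ card-free-≤ (line d v) (occupied d S) chosen (occupied-chosen d) ⟩
      n ∸ card chosen   ≡⟨ cong (n ∸_) (card-<ᵇ (m∸n≤m n k)) ⟩
      n ∸ (n ∸ k)       ≡⟨ m∸[m∸n]≡n (<⇒≤ k<n) ⟩
      k                 ∎
      where open ≤-Reasoning

    l₀-chosen : ∃ λ l → T (chosen l)
    l₀-chosen = card-nonempty chosen (≤-trans (m+n≤o⇒m≤o∸n 1 k<n) (≤-reflexive (sym (card-<ᵇ (m∸n≤m n k)))))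

    hub : Axis → Fin (suc n)
    hub d = punchIn (line d v) (proj₁ l₀-chosen)

    hub-occupied : ∀ d → T (occupied d S (hub d))
    hub-occupied d = occupied-chosen d (proj₁ l₀-chosen) (proj₂ l₀-chosen)

    Q₀ Q₁ : VSet G
    Q₀ = Pt G k S 0
    Q₁ = Pt G k S 1

    covered⇒Q₀ : ∀ d {y} → y ≢ v → T (occupied d S (line d y)) → T (Q₀ y)
    covered⇒Q₀ d y≢v occ with occupied⁻ d S _ occ
    ... | s , s∈S , same = P0⁺ G _ s∈S (N-line d (∈G⁻ (S⊆G s s∈S)) y≢v same)

    forced-along : ∀ (Q : VSet G) d {y} → y ≢ v →
                   (∀ w → w ≢ v → line (perp d) w ≡ hub (perp d) → T (Q w)) →
                   (∀ w → w ≢ v → line d w ≡ line d y → ¬ T (Q w) → T (free (perp d) S (line (perp d) w))) →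
                   T (step G k Q y)
    forced-along Q d {y} y≢v hub-line⊆Q unobserved⇒free =
      step⁺ G k Q y (∈G⁺ u≢v) (Qu , few-unobserved) (N-line d u≢v y≢v (line-along d (line d y) _))
      where
      u = along d (line d y) (hub (perp d))
      u≢v : u ≢ v
      u≢v u≡v = punchInᵢ≢i _ _ (trans (sym (line-perp-along d (line d y) _)) (cong (line (perp d)) u≡v))
      Qu : T (Q u)
      Qu = hub-line⊆Q u u≢v (line-perp-along d (line d y) _)
      F : Cell → Bool
      F x = N[_] G u x ∧ not (Q x)
      F⊆y-line : ∀ w → w ≢ v → T (F w) → line d w ≡ line d y
      F⊆y-line w w≢v Fw with to (T-∧ {N[_] G u w}) Fw
      ... | u→w , ¬Qw with N-line⁻ d u→w
      ...   | inj₁ same = trans (sym same) (line-along d (line d y) _)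
      ...   | inj₂ same = ⊥-elim (T-not⁻ ¬Qw (hub-line⊆Q w w≢v (trans (sym same) (line-perp-along d (line d y) _))))
      F⇒free : ∀ x → T (alive (along d (line d y) x) ∧ F (along d (line d y) x)) → T (free (perp d) S x)
      F⇒free x Fx with to (T-∧ {alive (along d (line d y) x)}) Fx
      ... | live , Fw = subst (T ∘ free (perp d) S) (line-perp-along d (line d y) x)
        (unobserved⇒free _ (alive⁻ live) (line-along d (line d y) x) (T-not⁻ (proj₂ (to (T-∧ {N[_] G u _}) Fw))))
      few-unobserved : count G F ≤ k
      few-unobserved = begin
        count G F                  ≤⟨ count≤lineCard d (line d y) F F⊆y-line ⟩
        lineCard d (line d y) F    ≤⟨ card-mono F⇒free ⟩
        card (free (perp d) S)     ≤⟨ few-free (perp d) ⟩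
        k                          ∎
        where open ≤-Reasoning

    Q₁-near : ∀ d {y} → y ≢ v → T (occupied d S (line d y)) ⊎ line d y ≡ line d v → T (Q₁ y)
    Q₁-near d {y} y≢v near = forced-along Q₀ d y≢v hub-line⊆Q₀ unobserved⇒free
      where
      hub-line⊆Q₀ : ∀ w → w ≢ v → line (perp d) w ≡ hub (perp d) → T (Q₀ w)
      hub-line⊆Q₀ w w≢v on-hub =
        covered⇒Q₀ (perp d) w≢v (subst (T ∘ occupied (perp d) S) (sym on-hub) (hub-occupied (perp d)))
      unobserved⇒free : ∀ w → w ≢ v → line d w ≡ line d y → ¬ T (Q₀ w) → T (free (perp d) S (line (perp d) w))
      unobserved⇒free w w≢v same ¬Q₀w =
        free⁺ (perp d) S _ (¬Q₀w ∘ covered⇒Q₀ (perp d) w≢v) off-v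
        where
        off-v : line (perp d) w ≢ line (perp d) v
        off-v on-v = [ (λ occ → ¬Q₀w (covered⇒Q₀ d w≢v (subst (T ∘ occupied d S) (sym same) occ)))
                     , (λ y-on-v → w≢v (cell-ext d (trans same y-on-v) on-v)) ]′ near

    Q₂-all : ∀ y → y ≢ v → T (Pt G k S 2 y)
    Q₂-all y y≢v = forced-along Q₁ row y≢v hub-line⊆Q₁ unobserved⇒free
      where
      hub-line⊆Q₁ : ∀ w → w ≢ v → proj₂ w ≡ hub col → T (Q₁ w)
      hub-line⊆Q₁ w w≢v on-hub = Q₁-near col w≢v (inj₁ (subst (T ∘ occupied col S) (sym on-hub) (hub-occupied col)))
      unobserved⇒free : ∀ w → w ≢ v → proj₁ w ≡ proj₁ y → ¬ T (Q₁ w) → T (free col S (proj₂ w))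
      unobserved⇒free w w≢v _ ¬Q₁w =
        free⁺ col S (proj₂ w) (¬Q₁w ∘ Q₁-near col w≢v ∘ inj₁) (¬Q₁w ∘ Q₁-near col w≢v ∘ inj₂)

    IsPDS-S : IsPDS G k S
    IsPDS-S = S⊆G , 2 , λ w w∈G → Q₂-all w (∈G⁻ w∈G)

  γPk≡n∸k : ∀ k → k < n → γPk≡ G k (n ∸ k)
  γPk≡n∸k k k<n = (S , unique-S , ∣S∣≡m , IsPDS-S) , minimal
    where
    open UpperBound k k<n using (S; unique-S; ∣S∣≡m; IsPDS-S)
    minimal : ∀ S′ → Unique S′ → IsPDS G k S′ → n ∸ k ≤ length S′
    minimal S′ _ S′-dominates =
      ≮⇒≥ λ ∣S′∣<n∸k → LowerBound.¬IsPDS k S′ (k<n∸∣S′∣ ∣S′∣<n∸k) S′-dominates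
      where
      k<n∸∣S′∣ : length S′ < n ∸ k → k < n ∸ length S′
      k<n∸∣S′∣ ∣S′∣<n∸k = m+n≤o⇒m≤o∸n (suc k) (subst (_≤ n) (cong suc (+-comm (length S′) k))
        (m≤o∸n⇒m+n≤o (suc (length S′)) (<⇒≤ k<n) ∣S′∣<n∸k))

mainTheorem7 : (k a : ℕ) → 1 ≤ k → k + 2 ≤ a →
    (v : V (KaKa a)) → v ∈ verts (KaKa a) →
    γPk≡ (KaKa a -v v) k (a ∸ k ∸ 1)
mainTheorem7 k zero    _ _ (() , _) _
mainTheorem7 k (suc n) _ k+2≤a v _ =
  subst (γPk≡ (KaKa (suc n) -v v) k) (sym a∸k∸1≡n∸k) (Rook.γPk≡n∸k n v k k<n)
  where
  k<n : k < n
  k<n = ≤-pred (subst (_≤ suc n) (+-comm k 2) k+2≤a)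
  a∸k∸1≡n∸k : suc n ∸ k ∸ 1 ≡ n ∸ k
  a∸k∸1≡n∸k = trans (∸-+-assoc (suc n) k 1) (cong (suc n ∸_) (+-comm k 1))
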